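{- For any cycle graph $C_n$ ($n\ge 3$), $pd_s(C_n)=3$.
   Context: Graphs are finite, simple, connected; $d_G$ is shortest-path distance, $d_G(x,W)=\min\{d_G(x,w):w\in W\}$. A set $W$ strongly resolves different vertices $x,y\notin W$ if $d_G(x,W)=d_G(x,y)+d_G(y,W)$ or $d_G(y,W)=d_G(y,x)+d_G(x,W)$. A vertex partition $\Pi$ is a strong resolving partition if every two different vertices in the same set of $\Pi$ are strongly resolved by some set of $\Pi$; the strong partition dimension $pd_s(G)$ is the minimum cardinality of such a partition. -}

module Defs where

open import Data.Bool using (Bool; true; false; _∧_; _∨_; if_then_else_)
open import Data.Nat using (ℕ; zero; suc; _+_; _⊓_; _%_; _<_; _≥_)
open import Data.Fin using (Fin; toℕ)
open import Data.Fin.Properties using () renaming (_≟_ to _≟F_)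
open import Data.Nat.Properties using () renaming (_≟_ to _≟ℕ_)
open import Data.List using (List; foldr; map)
open import Data.Bool.ListAction using (any)
open import Data.List using (allFin)
open import Data.Product using (Σ; ∃; _×_)
open import Data.Sum using (_⊎_)
open import Relation.Nullary using (¬_)
open import Relation.Nullary.Decidable using (⌊_⌋)
open import Relation.Binary.PropositionalEquality using (_≡_; _≢_)

Graph : ℕ → Set
Graph n = Fin n → Fin n → Bool

reachIn : ∀ {n} → Graph n → ℕ → Fin n → Fin n → Bool
reachIn G zero    x y = ⌊ x ≟F y ⌋
reachIn G (suc k) x y = reachIn G k x y ∨ any (λ z → reachIn G k x z ∧ G z y) (allFin _)

searchDist : ∀ {n} → Graph n → Fin n → Fin n → (fuel start : ℕ) → ℕ
searchDist G x y zero       start = start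
searchDist G x y (suc fuel) start =
  if reachIn G start x y then start else searchDist G x y fuel (suc start)

-- shortest-path distance d_G(x,y) (for a connected graph on n vertices the
-- distance is < n, so a search over 0..n is exhaustive)
dist : ∀ {n} → Graph n → Fin n → Fin n → ℕ
dist {n} G x y = searchDist G x y n 0

cycleGraph : (n : ℕ) → Graph n
cycleGraph n i j =
  ⌊ toℕ j ≟ℕ suc (toℕ i) ⌋ ∨ ⌊ toℕ i ≟ℕ suc (toℕ j) ⌋ ∨
  (⌊ toℕ i ≟ℕ 0 ⌋ ∧ ⌊ suc (toℕ j) ≟ℕ n ⌋) ∨ (⌊ toℕ j ≟ℕ 0 ⌋ ∧ ⌊ suc (toℕ i) ≟ℕ n ⌋)

-- A vertex partition Π = {S_0,…,S_{k-1}} of Fin n into k (nonempty) classes is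
-- represented by a surjective class map f : Fin n → Fin k, with S_c = f⁻¹(c).
IsPartition : ∀ {n k} → (Fin n → Fin k) → Set
IsPartition f = ∀ c → ∃ λ v → f v ≡ c

-- The fold starts at n, which is an
-- upper bound for all distances in a connected graph on n vertices, so for a
-- nonempty class this is exactly the minimum.
distClass : ∀ {n k} → Graph n → (Fin n → Fin k) → Fin k → Fin n → ℕ
distClass {n} G f c x =
  foldr _⊓_ n (map (λ w → if ⌊ f w ≟F c ⌋ then dist G x w else n) (allFin n))

StronglyResolves : ∀ {n k} → Graph n → (Fin n → Fin k) → Fin k → Fin n → Fin n → Set
StronglyResolves G f c x y =
  f x ≢ c × f y ≢ c ×
  (distClass G f c x ≡ dist G x y + distClass G f c y
   ⊎ distClass G f c y ≡ dist G y x + distClass G f c x)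

IsStrongResolvingPartition : ∀ {n k} → Graph n → (Fin n → Fin k) → Set
IsStrongResolvingPartition G f =
  IsPartition f ×
  (∀ x y → x ≢ y → f x ≡ f y → ∃ λ c → StronglyResolves G f c x y)

StrongPartitionDimension : ∀ {n} → Graph n → ℕ → Set
StrongPartitionDimension {n} G m =
  (Σ (Fin n → Fin m) λ f → IsStrongResolvingPartition G f) ×
  (∀ k → k < m → (f : Fin n → Fin k) → ¬ IsStrongResolvingPartition G f)

module Submission where

-- Split C_n into S₀ = {0}, S₁ = {t : 0 < t, 2t ≤ n} and
-- S₂ = {t : 2t > n}.  The distance of t to 0 is depth t = min (t, n − t), and
-- within S₁ (resp. S₂) the vertex closer to 0 lies on a shortest path from the
-- other one to 0, so S₀ strongly resolves every pair inside S₁ or S₂.  Exact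
-- distances are certified by an explicit walk together with the 1-Lipschitz
-- potential depth, which bounds the length of every walk from below.
--
-- One class cannot resolve anything.  For two classes, if two
-- distinct vertices x, y of one class both have a neighbour in the other class,
-- then both are at distance 1 from that class, which therefore cannot resolve
-- them strongly (this would force d(x, y) = 0).  On a 2-coloured cycle such a
-- "boundary pair" always exists: take the endpoints of two crossing edges.

open import Defs
open import Data.Nat using (ℕ; _≥_)
open import Data.Nat.Base using (zero; suc; _+_; _∸_; _⊓_; _≤_; _<_; z≤n; s≤s; s≤s⁻¹)
open import Data.Nat.Properties
open import Data.Fin using (Fin; toℕ; fromℕ; fromℕ<) renaming (zero to 0F; suc to sucF)
open import Data.Fin.Properties using (toℕ-injective; toℕ-fromℕ; toℕ-fromℕ<; toℕ<n)
  renaming (_≟_ to _≟F_)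
open import Data.Bool using (true; false; T; if_then_else_)
open import Data.Bool.Properties using (T-∨; T-∧)
open import Data.Empty using (⊥; ⊥-elim)
open import Data.List using (List; []; _∷_; foldr; map; allFin)
import Data.List.Relation.Unary.Any as Any
open import Data.List.Relation.Unary.Any using (satisfied)
open import Data.List.Relation.Unary.Any.Properties using (any⁺; any⁻)
open import Data.List.Membership.Propositional using (_∈_)
open import Data.List.Membership.Propositional.Properties using (∈-allFin)
open import Data.Product using (∃; _×_; _,_; proj₁; proj₂)
open import Data.Sum using (_⊎_; inj₁; inj₂; swap)
open import Relation.Nullary using (¬_; yes; no)
open import Relation.Nullary.Decidable using (⌊_⌋; toWitness; fromWitness)
open import Relation.Binary.Definitions using (DecidableEquality; Tri; tri<; tri≈; tri>)
open import Relation.Binary.PropositionalEquality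
open import Function.Bundles using (Equivalence)
open Equivalence using (to; from)

module ShortestPaths {n : ℕ} (G : Graph n) where

  Walk : ℕ → Fin n → Fin n → Set
  Walk k x y = T (reachIn G k x y)

  walk-refl : ∀ x → Walk 0 x x
  walk-refl x = fromWitness {a? = x ≟F x} refl

  walk-zero : ∀ x y → Walk 0 x y → x ≡ y
  walk-zero x y w = toWitness {a? = x ≟F y} w

  walk-snoc : ∀ k x z y → Walk k x z → T (G z y) → Walk (suc k) x y
  walk-snoc k x z y w e =
    from T-∨ (inj₂ (any⁺ _ (Any.map (λ { refl → from T-∧ (w , e) }) (∈-allFin z))))

  walk-unsnoc : ∀ k x y → Walk (suc k) x y → Walk k x y ⊎ ∃ λ z → Walk k x z × T (G z y)
  walk-unsnoc k x y w with to T-∨ w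
  ... | inj₁ shorter = inj₁ shorter
  ... | inj₂ step with satisfied (any⁻ _ (allFin n) step)
  ...   | z , final-step = inj₂ (z , to T-∧ final-step)

  module Potential (φ : Fin n → ℕ) (lipschitz : ∀ z y → T (G z y) → φ z ≤ suc (φ y)) where

    walk-length-bound : ∀ k x y → Walk k x y → φ x ≤ φ y + k
    walk-length-bound zero x y w rewrite walk-zero x y w = ≤-reflexive (sym (+-identityʳ (φ y)))
    walk-length-bound (suc k) x y w with walk-unsnoc k x y w
    ... | inj₁ shorter = ≤-trans (walk-length-bound k x y shorter) (+-monoʳ-≤ (φ y) (n≤1+n k))
    ... | inj₂ (z , w′ , e) = begin
      φ x           ≤⟨ walk-length-bound k x z w′ ⟩
      φ z + k       ≤⟨ +-monoˡ-≤ k (lipschitz z y e) ⟩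
      suc (φ y) + k ≡⟨ sym (+-suc (φ y) k) ⟩
      φ y + suc k   ∎
      where open ≤-Reasoning

  search-≤ : ∀ x y fuel s → searchDist G x y fuel s ≤ s + fuel
  search-≤ x y zero s = ≤-reflexive (sym (+-identityʳ s))
  search-≤ x y (suc fuel) s with reachIn G s x y
  ... | true = m≤m+n s (suc fuel)
  ... | false = ≤-trans (search-≤ x y fuel (suc s)) (≤-reflexive (sym (+-suc s fuel)))

  search-stops : ∀ x y fuel s →
    Walk (searchDist G x y fuel s) x y ⊎ searchDist G x y fuel s ≡ s + fuel
  search-stops x y zero s = inj₂ (sym (+-identityʳ s))
  search-stops x y (suc fuel) s with reachIn G s x y in reach
  ... | true = inj₁ (subst T (sym reach) _)
  ... | false with search-stops x y fuel (suc s)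
  ...   | inj₁ found = inj₁ found
  ...   | inj₂ exhausted = inj₂ (trans exhausted (sym (+-suc s fuel)))

  search-minimal : ∀ x y fuel s k → s ≤ k → k ≤ s + fuel → Walk k x y → searchDist G x y fuel s ≤ k
  search-minimal x y zero s k s≤k _ _ = s≤k
  search-minimal x y (suc fuel) s k s≤k k≤ w with reachIn G s x y in reach
  ... | true = s≤k
  ... | false with m≤n⇒m<n∨m≡n s≤k
  ...   | inj₂ refl = ⊥-elim (subst T reach w)
  ...   | inj₁ s<k = search-minimal x y fuel (suc s) k s<k (≤-trans k≤ (≤-reflexive (+-suc s fuel))) w

  dist-≤n : ∀ x y → dist G x y ≤ n
  dist-≤n x y = search-≤ x y n 0

  dist-upper : ∀ x y k → Walk k x y → k ≤ n → dist G x y ≤ k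
  dist-upper x y k w k≤n = search-minimal x y n 0 k z≤n k≤n w

  dist-lower : ∀ x y d → (∀ k → Walk k x y → d ≤ k) → d ≤ n → d ≤ dist G x y
  dist-lower x y d below d≤n with search-stops x y n 0
  ... | inj₁ found = below _ found
  ... | inj₂ exhausted = subst (d ≤_) (sym exhausted) d≤n

  dist-certified : (φ : Fin n → ℕ) (lipschitz : ∀ z y → T (G z y) → φ z ≤ suc (φ y)) →
    ∀ x y k → Walk k x y → k ≤ n → φ x ≡ k + φ y → dist G x y ≡ k
  dist-certified φ lipschitz x y k w k≤n drop =
    ≤-antisym (dist-upper x y k w k≤n) (dist-lower x y k below k≤n)
    where
    open Potential φ lipschitz
    below : ∀ j → Walk j x y → k ≤ j
    below j w′ = +-cancelʳ-≤ (φ y) k j (begin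
      k + φ y ≡⟨ sym drop ⟩
      φ x     ≤⟨ walk-length-bound j x y w′ ⟩
      φ y + j ≡⟨ +-comm (φ y) j ⟩
      j + φ y ∎)
      where open ≤-Reasoning

  nonempty : Fin n → 1 ≤ n
  nonempty x = ≤-trans (s≤s z≤n) (toℕ<n x)

  dist-positive : ∀ x y → x ≢ y → 1 ≤ dist G x y
  dist-positive x y x≢y = dist-lower x y 1 below (nonempty x)
    where
    below : ∀ k → Walk k x y → 1 ≤ k
    below zero w = ⊥-elim (x≢y (walk-zero x y w))
    below (suc k) _ = s≤s z≤n

  dist-adjacent : ∀ x y → x ≢ y → T (G x y) → dist G x y ≡ 1
  dist-adjacent x y x≢y e =
    ≤-antisym (dist-upper x y 1 (walk-snoc 0 x x y (walk-refl x) e) (nonempty x)) (dist-positive x y x≢y)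

foldr-⊓-≤ : ∀ {A : Set} (g : A → ℕ) b (xs : List A) w → w ∈ xs → foldr _⊓_ b (map g xs) ≤ g w
foldr-⊓-≤ g b (x ∷ xs) w (Any.here refl) = m⊓n≤m (g x) _
foldr-⊓-≤ g b (x ∷ xs) w (Any.there w∈xs) = ≤-trans (m⊓n≤n (g x) _) (foldr-⊓-≤ g b xs w w∈xs)

foldr-⊓-≥ : ∀ {A : Set} (g : A → ℕ) b (xs : List A) d → d ≤ b → (∀ w → d ≤ g w) →
  d ≤ foldr _⊓_ b (map g xs)
foldr-⊓-≥ g b [] d d≤b _ = d≤b
foldr-⊓-≥ g b (x ∷ xs) d d≤b below = ⊓-glb (below x) (foldr-⊓-≥ g b xs d d≤b below)

distClass-attained : ∀ {n k} (G : Graph n) (f : Fin n → Fin k) c x d → d ≤ n →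
  (∀ w → f w ≡ c → d ≤ dist G x w) → (w₀ : Fin n) → f w₀ ≡ c → dist G x w₀ ≡ d →
  distClass G f c x ≡ d
distClass-attained {n} G f c x d d≤n below w₀ w₀∈c dist≡d =
  ≤-antisym (≤-trans (foldr-⊓-≤ g n (allFin n) w₀ (∈-allFin w₀)) attained)
            (foldr-⊓-≥ g n (allFin n) d d≤n bounded)
  where
  g : Fin n → ℕ
  g w = if ⌊ f w ≟F c ⌋ then dist G x w else n
  attained : g w₀ ≤ d
  attained with f w₀ ≟F c
  ... | yes _ = ≤-reflexive dist≡d
  ... | no w₀∉c = ⊥-elim (w₀∉c w₀∈c)
  bounded : ∀ w → d ≤ g w
  bounded w with f w ≟F c
  ... | yes w∈c = below w w∈c
  ... | no _ = d≤n

-- A class adjacent to both x and y cannot strongly resolve them: both are at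
-- distance 1 from it, while strong resolution would need a positive difference.
module AdjacentClass {n k : ℕ} (G : Graph n) (f : Fin n → Fin k) (c : Fin k) where
  open ShortestPaths G

  distClass-adjacent : ∀ x w → f x ≢ c → f w ≡ c → T (G x w) → distClass G f c x ≡ 1
  distClass-adjacent x w x∉c w∈c e = distClass-attained G f c x 1 (nonempty x)
    (λ v v∈c → dist-positive x v (λ { refl → x∉c v∈c })) w w∈c
    (dist-adjacent x w (λ { refl → x∉c w∈c }) e)

  adjacent-not-geodesic : ∀ x y x′ y′ → x ≢ y → f x ≢ c → f y ≢ c →
    f x′ ≡ c → f y′ ≡ c → T (G x x′) → T (G y y′) →
    distClass G f c x ≢ dist G x y + distClass G f c y
  adjacent-not-geodesic x y x′ y′ x≢y x∉c y∉c x′∈c y′∈c ex ey geodesic =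
    <⇒≢ (dist-positive x y x≢y) (sym (+-cancelʳ-≡ 1 (dist G x y) 0 (begin
      dist G x y + 1
        ≡⟨ cong (dist G x y +_) (sym (distClass-adjacent y y′ y∉c y′∈c ey)) ⟩
      dist G x y + distClass G f c y ≡⟨ sym geodesic ⟩
      distClass G f c x              ≡⟨ distClass-adjacent x x′ x∉c x′∈c ex ⟩
      1                              ∎)))
    where open ≡-Reasoning

  adjacent-unresolving : ∀ x y x′ y′ → x ≢ y → f x′ ≡ c → f y′ ≡ c →
    T (G x x′) → T (G y y′) → ¬ StronglyResolves G f c x y
  adjacent-unresolving x y x′ y′ x≢y x′∈c y′∈c ex ey (x∉c , y∉c , inj₁ geodesic) =
    adjacent-not-geodesic x y x′ y′ x≢y x∉c y∉c x′∈c y′∈c ex ey geodesic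
  adjacent-unresolving x y x′ y′ x≢y x′∈c y′∈c ex ey (x∉c , y∉c , inj₂ geodesic) =
    adjacent-not-geodesic y x y′ x′ (λ y≡x → x≢y (sym y≡x)) y∉c x∉c y′∈c x′∈c ey ex geodesic

one-class : (c d : Fin 1) → c ≡ d
one-class 0F 0F = refl

flip : Fin 2 → Fin 2
flip 0F = sucF 0F
flip (sucF 0F) = 0F

flip-≢ : ∀ c → flip c ≢ c
flip-≢ 0F ()
flip-≢ (sucF 0F) ()

other-colour : (a b c : Fin 2) → b ≢ a → c ≢ a → b ≡ c
other-colour 0F 0F _ b≢a _ = ⊥-elim (b≢a refl)
other-colour 0F (sucF 0F) 0F _ c≢a = ⊥-elim (c≢a refl)
other-colour 0F (sucF 0F) (sucF 0F) _ _ = refl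
other-colour (sucF 0F) 0F 0F _ _ = refl
other-colour (sucF 0F) 0F (sucF 0F) _ c≢a = ⊥-elim (c≢a refl)
other-colour (sucF 0F) (sucF 0F) _ b≢a _ = ⊥-elim (b≢a refl)

record BoundaryPair {n : ℕ} (G : Graph n) (f : Fin n → Fin 2) : Set where
  constructor boundary-pair
  field
    x y x′ y′  : Fin n
    distinct   : x ≢ y
    same-class : f x ≡ f y
    x′-outside : f x′ ≢ f x
    y′-outside : f y′ ≢ f y
    x-edge     : T (G x x′)
    y-edge     : T (G y y′)

-- A boundary pair defeats every 2-class partition: the only class that could
-- resolve it is the other class, which is adjacent to both vertices.
boundary-pair-unresolvable : ∀ {n} (G : Graph n) (f : Fin n → Fin 2) →
  BoundaryPair G f → ¬ IsStrongResolvingPartition G f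
boundary-pair-unresolvable G f (boundary-pair x y x′ y′ x≢y fx≡fy x′-out y′-out ex ey) (_ , resolved)
  with resolved x y x≢y fx≡fy
... | c , resolves@(x∉c , y∉c , _) =
  AdjacentClass.adjacent-unresolving G f c x y x′ y′ x≢y
    (other-colour (f x) (f x′) c x′-out (λ c≡fx → x∉c (sym c≡fx)))
    (other-colour (f y) (f y′) c y′-out (λ c≡fy → y∉c (sym c≡fy)))
    ex ey resolves

first-change : ∀ {A : Set} → DecidableEquality A → (q : ℕ → A) → ∀ a b → a ≤ b → q b ≢ q a →
  ∃ λ i → a ≤ i × i < b × q i ≡ q a × q (suc i) ≢ q a
first-change _≟_ q a zero z≤n qb≢qa = ⊥-elim (qb≢qa refl)
first-change _≟_ q a (suc b) a≤1+b q1+b≢qa with m≤n⇒m<n∨m≡n a≤1+b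
... | inj₂ refl = ⊥-elim (q1+b≢qa refl)
... | inj₁ (s≤s a≤b) with q b ≟ q a
...   | yes qb≡qa = b , a≤b , ≤-refl , qb≡qa , q1+b≢qa
...   | no qb≢qa with first-change _≟_ q a b a≤b qb≢qa
...     | i , a≤i , i<b , qi≡qa , change = i , a≤i , m<n⇒m<1+n i<b , qi≡qa , change

module CycleEdges (n : ℕ) where

  G : Graph n
  G = cycleGraph n

  data CycleEdge (i j : Fin n) : Set where
    forward  : toℕ j ≡ suc (toℕ i) → CycleEdge i j
    backward : toℕ i ≡ suc (toℕ j) → CycleEdge i j
    wrap-out : toℕ i ≡ 0 → suc (toℕ j) ≡ n → CycleEdge i j
    wrap-in  : toℕ j ≡ 0 → suc (toℕ i) ≡ n → CycleEdge i j

  edge-kind : ∀ i j → T (G i j) → CycleEdge i j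
  edge-kind i j e with toℕ j ≟ suc (toℕ i) | toℕ i ≟ suc (toℕ j)
                     | toℕ i ≟ 0 | suc (toℕ j) ≟ n | toℕ j ≟ 0 | suc (toℕ i) ≟ n
  ... | yes p | _     | _     | _     | _     | _     = forward p
  ... | no _  | yes p | _     | _     | _     | _     = backward p
  ... | no _  | no _  | yes p | yes q | _     | _     = wrap-out p q
  ... | no _  | no _  | _     | _     | yes p | yes q = wrap-in p q
  ... | no _  | no _  | no _  | _     | no _  | _     = ⊥-elim e
  ... | no _  | no _  | no _  | _     | yes _ | no _  = ⊥-elim e
  ... | no _  | no _  | yes _ | no _  | no _  | _     = ⊥-elim e
  ... | no _  | no _  | yes _ | no _  | yes _ | no _  = ⊥-elim e

  forward-edge : ∀ i j → toℕ j ≡ suc (toℕ i) → T (G i j)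
  forward-edge i j p with toℕ j ≟ suc (toℕ i)
  ... | yes _ = _
  ... | no ¬p = ⊥-elim (¬p p)

  backward-edge : ∀ i j → toℕ i ≡ suc (toℕ j) → T (G i j)
  backward-edge i j p with toℕ j ≟ suc (toℕ i) | toℕ i ≟ suc (toℕ j)
  ... | yes _ | _ = _
  ... | no _ | yes _ = _
  ... | no _ | no ¬p = ⊥-elim (¬p p)

  wrap-out-edge : ∀ i j → toℕ i ≡ 0 → suc (toℕ j) ≡ n → T (G i j)
  wrap-out-edge i j p q with toℕ j ≟ suc (toℕ i) | toℕ i ≟ suc (toℕ j)
                             | toℕ i ≟ 0 | suc (toℕ j) ≟ n
  ... | yes _ | _     | _     | _     = _
  ... | no _  | yes _ | _     | _     = _
  ... | no _  | no _  | yes _ | yes _ = _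
  ... | no _  | no _  | no ¬p | _     = ⊥-elim (¬p p)
  ... | no _  | no _  | yes _ | no ¬q = ⊥-elim (¬q q)

  wrap-in-edge : ∀ i j → toℕ j ≡ 0 → suc (toℕ i) ≡ n → T (G i j)
  wrap-in-edge i j p q with toℕ j ≟ suc (toℕ i) | toℕ i ≟ suc (toℕ j)
                          | toℕ i ≟ 0 | suc (toℕ j) ≟ n | toℕ j ≟ 0 | suc (toℕ i) ≟ n
  ... | yes _ | _     | _     | _     | _     | _     = _
  ... | no _  | yes _ | _     | _     | _     | _     = _
  ... | no _  | no _  | yes _ | yes _ | _     | _     = _
  ... | no _  | no _  | yes _ | no _  | yes _ | yes _ = _
  ... | no _  | no _  | no _  | _     | yes _ | yes _ = _
  ... | no _  | no _  | _     | _     | no ¬p | _     = ⊥-elim (¬p p)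
  ... | no _  | no _  | _     | _     | yes _ | no ¬q = ⊥-elim (¬q q)

-- Geometry of the cycle C_n with n = L + 1 vertices 0, …, L: the distance
-- of a vertex t to the origin 0 is depth t = min (t, n − t).
module CycleGeometry (L : ℕ) where

  n : ℕ
  n = suc L

  open CycleEdges n public
  open ShortestPaths G public

  origin last : Fin n
  origin = 0F
  last = fromℕ L

  depth : ℕ → ℕ
  depth t = t ⊓ (n ∸ t)

  depth-near : ∀ t → t + t ≤ n → depth t ≡ t
  depth-near t t+t≤n = m≤n⇒m⊓n≡m (m+n≤o⇒m≤o∸n t t+t≤n)

  depth-far : ∀ t → n < t + t → depth t ≡ n ∸ t
  depth-far t n<t+t = m≥n⇒m⊓n≡n (m≤n+o⇒m∸n≤o n t (<⇒≤ n<t+t))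

  depth-step : ∀ t → depth t ≤ suc (depth (suc t)) × depth (suc t) ≤ suc (depth t)
  depth-step t =
    ⊓-mono-≤ (m≤n⇒m≤1+n (n≤1+n t)) (n∸t≤1+n∸[1+t] n t) ,
    ⊓-mono-≤ ≤-refl (m≤n⇒m≤1+n (∸-monoʳ-≤ n (n≤1+n t)))
    where
    n∸t≤1+n∸[1+t] : ∀ m t → m ∸ t ≤ suc (m ∸ suc t)
    n∸t≤1+n∸[1+t] zero zero = z≤n
    n∸t≤1+n∸[1+t] zero (suc t) = z≤n
    n∸t≤1+n∸[1+t] (suc m) zero = ≤-refl
    n∸t≤1+n∸[1+t] (suc m) (suc t) = n∸t≤1+n∸[1+t] m t

  depth-lipschitz : ∀ z y → T (G z y) → depth (toℕ z) ≤ suc (depth (toℕ y))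
  depth-lipschitz z y e with edge-kind z y e
  ... | forward p rewrite p = proj₁ (depth-step (toℕ z))
  ... | backward p rewrite p = proj₂ (depth-step (toℕ y))
  ... | wrap-out p _ rewrite p = z≤n
  ... | wrap-in p q rewrite p = ≤-trans (m⊓n≤n (toℕ z) (n ∸ toℕ z)) (≤-reflexive n∸z≡1)
    where
    n∸z≡1 : n ∸ toℕ z ≡ 1
    n∸z≡1 = trans (cong (_∸ toℕ z) (sym q)) (m+n∸n≡m 1 (toℕ z))

  walk-up : ∀ d (u w : Fin n) → toℕ w ≡ toℕ u + d → Walk d u w
  walk-up zero u w w≡u rewrite toℕ-injective {i = w} {j = u} (trans w≡u (+-identityʳ _)) = walk-refl _
  walk-up (suc d) u w w≡u+1+d = walk-snoc d u z w (walk-up d u z (toℕ-fromℕ< u+d<n)) z→w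
    where
    u+d<n : toℕ u + d < n
    u+d<n = ≤-trans (≤-reflexive (sym (+-suc (toℕ u) d))) (<⇒≤ (subst (_< n) w≡u+1+d (toℕ<n w)))
    z : Fin n
    z = fromℕ< u+d<n
    z→w : T (G z w)
    z→w = forward-edge z w (trans w≡u+1+d (trans (+-suc (toℕ u) d) (cong suc (sym (toℕ-fromℕ< u+d<n)))))

  walk-down : ∀ d (u w : Fin n) → toℕ u ≡ toℕ w + d → Walk d u w
  walk-down zero u w u≡w rewrite toℕ-injective {i = u} {j = w} (trans u≡w (+-identityʳ _)) = walk-refl _
  walk-down (suc d) u w u≡w+1+d = walk-snoc d u z w (walk-down d u z u≡z+d) z→w
    where
    w+1<n : suc (toℕ w) < n
    w+1<n = ≤-trans (s≤s (m≤m+n (suc (toℕ w)) d))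
                    (subst (_< n) (trans u≡w+1+d (+-suc (toℕ w) d)) (toℕ<n u))
    z : Fin n
    z = fromℕ< w+1<n
    u≡z+d : toℕ u ≡ toℕ z + d
    u≡z+d = trans u≡w+1+d (trans (+-suc (toℕ w) d) (cong (_+ d) (sym (toℕ-fromℕ< w+1<n))))
    z→w : T (G z w)
    z→w = backward-edge z w (toℕ-fromℕ< w+1<n)

  walk-around : ∀ u → Walk (n ∸ toℕ u) u origin
  walk-around u = subst (λ k → Walk k u origin) (sym (+-∸-assoc 1 u≤L))
    (walk-snoc (L ∸ toℕ u) u last origin
      (walk-up (L ∸ toℕ u) u last (trans (toℕ-fromℕ L) (sym (m+[n∸m]≡n u≤L))))
      (wrap-in-edge last origin refl (cong suc (toℕ-fromℕ L))))
    where
    u≤L : toℕ u ≤ L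
    u≤L = s≤s⁻¹ (toℕ<n u)

  depth-certified : ∀ x y k → Walk k x y → k ≤ n → depth (toℕ x) ≡ k + depth (toℕ y) →
    dist G x y ≡ k
  depth-certified = dist-certified (λ u → depth (toℕ u)) depth-lipschitz

  dist-to-origin : ∀ u → dist G u origin ≡ depth (toℕ u)
  dist-to-origin u with toℕ u + toℕ u ≤? n
  ... | yes near = trans
    (depth-certified u origin (toℕ u) (walk-down (toℕ u) u origin refl) (<⇒≤ (toℕ<n u))
      (trans depth≡u (sym (+-identityʳ (toℕ u)))))
    (sym depth≡u)
    where
    depth≡u : depth (toℕ u) ≡ toℕ u
    depth≡u = depth-near (toℕ u) near
  ... | no far = trans
    (depth-certified u origin (n ∸ toℕ u) (walk-around u) (m∸n≤m n (toℕ u))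
      (trans depth≡n-u (sym (+-identityʳ (n ∸ toℕ u)))))
    (sym depth≡n-u)
    where
    depth≡n-u : depth (toℕ u) ≡ n ∸ toℕ u
    depth≡n-u = depth-far (toℕ u) (≰⇒> far)

  on-geodesic-to-origin : ∀ x y k → Walk k x y → k ≤ n → depth (toℕ x) ≡ k + depth (toℕ y) →
    dist G x origin ≡ dist G x y + dist G y origin
  on-geodesic-to-origin x y k w k≤n drop = begin
    dist G x origin                 ≡⟨ dist-to-origin x ⟩
    depth (toℕ x)                   ≡⟨ drop ⟩
    k + depth (toℕ y)
      ≡⟨ cong₂ _+_ (sym (depth-certified x y k w k≤n drop)) (sym (dist-to-origin y)) ⟩
    dist G x y + dist G y origin    ∎
    where open ≡-Reasoning

module CycleDimension (k : ℕ) where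

  open CycleGeometry (suc (suc k))

  side : ℕ → Fin 3
  side zero = 0F
  side (suc t) with suc t + suc t ≤? n
  ... | yes _ = sucF 0F
  ... | no _ = sucF (sucF 0F)

  data Side (t : ℕ) : Fin 3 → Set where
    at-origin : t ≡ 0 → Side t 0F
    near-half : t + t ≤ n → Side t (sucF 0F)
    far-half  : n < t + t → Side t (sucF (sucF 0F))

  side-view : ∀ t → Side t (side t)
  side-view zero = at-origin refl
  side-view (suc t) with suc t + suc t ≤? n
  ... | yes near = near-half near
  ... | no far = far-half (≰⇒> far)

  partition : Fin n → Fin 3
  partition u = side (toℕ u)

  only-origin-in-S₀ : ∀ w → partition w ≡ 0F → w ≡ origin
  only-origin-in-S₀ w w∈S₀ with side (toℕ w) | side-view (toℕ w)
  ... | _ | at-origin w≡0 = toℕ-injective w≡0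
  only-origin-in-S₀ w () | _ | near-half _
  only-origin-in-S₀ w () | _ | far-half _

  distance-to-S₀ : ∀ v → distClass G partition 0F v ≡ dist G v origin
  distance-to-S₀ v = distClass-attained G partition 0F v (dist G v origin) (dist-≤n v origin)
    (λ w w∈S₀ → ≤-reflexive (cong (dist G v) (sym (only-origin-in-S₀ w w∈S₀)))) origin refl refl

  near-pair-geodesic : ∀ x y → toℕ x < toℕ y → toℕ x + toℕ x ≤ n → toℕ y + toℕ y ≤ n →
    dist G y origin ≡ dist G y x + dist G x origin
  near-pair-geodesic x y x<y x-near y-near =
    on-geodesic-to-origin y x (toℕ y ∸ toℕ x) (walk-down _ y x (sym (m+[n∸m]≡n x≤y)))
      (≤-trans (m∸n≤m (toℕ y) (toℕ x)) (<⇒≤ (toℕ<n y))) drop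
    where
    x≤y : toℕ x ≤ toℕ y
    x≤y = <⇒≤ x<y
    drop : depth (toℕ y) ≡ (toℕ y ∸ toℕ x) + depth (toℕ x)
    drop = begin
      depth (toℕ y)                 ≡⟨ depth-near (toℕ y) y-near ⟩
      toℕ y                         ≡⟨ sym (m∸n+n≡m x≤y) ⟩
      (toℕ y ∸ toℕ x) + toℕ x       ≡⟨ cong ((toℕ y ∸ toℕ x) +_) (sym (depth-near (toℕ x) x-near)) ⟩
      (toℕ y ∸ toℕ x) + depth (toℕ x) ∎
      where open ≡-Reasoning

  far-pair-geodesic : ∀ x y → toℕ x < toℕ y → n < toℕ x + toℕ x → n < toℕ y + toℕ y →
    dist G x origin ≡ dist G x y + dist G y origin
  far-pair-geodesic x y x<y x-far y-far =
    on-geodesic-to-origin x y (toℕ y ∸ toℕ x) (walk-up _ x y (sym (m+[n∸m]≡n x≤y)))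
      (≤-trans (m∸n≤m (toℕ y) (toℕ x)) (<⇒≤ (toℕ<n y))) drop
    where
    x≤y : toℕ x ≤ toℕ y
    x≤y = <⇒≤ x<y
    drop : depth (toℕ x) ≡ (toℕ y ∸ toℕ x) + depth (toℕ y)
    drop = begin
      depth (toℕ x)                   ≡⟨ depth-far (toℕ x) x-far ⟩
      n ∸ toℕ x                       ≡⟨ cong (_∸ toℕ x) (sym (m∸n+n≡m (<⇒≤ (toℕ<n y)))) ⟩
      ((n ∸ toℕ y) + toℕ y) ∸ toℕ x   ≡⟨ +-∸-assoc (n ∸ toℕ y) x≤y ⟩
      (n ∸ toℕ y) + (toℕ y ∸ toℕ x)   ≡⟨ +-comm (n ∸ toℕ y) _ ⟩
      (toℕ y ∸ toℕ x) + (n ∸ toℕ y)   ≡⟨ cong ((toℕ y ∸ toℕ x) +_) (sym (depth-far (toℕ y) y-far)) ⟩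
      (toℕ y ∸ toℕ x) + depth (toℕ y) ∎
      where open ≡-Reasoning

  resolved-by-S₀ : ∀ x y → dist G x origin ≡ dist G x y + dist G y origin →
    distClass G partition 0F x ≡ dist G x y + distClass G partition 0F y
  resolved-by-S₀ x y geodesic =
    trans (distance-to-S₀ x) (trans geodesic (cong (dist G x y +_) (sym (distance-to-S₀ y))))

  same-half-resolved : ∀ x y → toℕ x < toℕ y → partition x ≡ partition y → partition x ≢ 0F →
    distClass G partition 0F x ≡ dist G x y + distClass G partition 0F y ⊎
    distClass G partition 0F y ≡ dist G y x + distClass G partition 0F x
  same-half-resolved x y x<y same x∉S₀
    with side (toℕ x) | side-view (toℕ x) | side (toℕ y) | side-view (toℕ y)
  ... | _ | at-origin _ | _ | _ = ⊥-elim (x∉S₀ refl)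
  ... | _ | near-half x-near | _ | near-half y-near =
    inj₂ (resolved-by-S₀ y x (near-pair-geodesic x y x<y x-near y-near))
  ... | _ | far-half x-far | _ | far-half y-far =
    inj₁ (resolved-by-S₀ x y (far-pair-geodesic x y x<y x-far y-far))
  same-half-resolved x y x<y () x∉S₀ | _ | near-half _ | _ | at-origin _
  same-half-resolved x y x<y () x∉S₀ | _ | near-half _ | _ | far-half _
  same-half-resolved x y x<y () x∉S₀ | _ | far-half _ | _ | at-origin _
  same-half-resolved x y x<y () x∉S₀ | _ | far-half _ | _ | near-half _

  partition-strongly-resolving : IsStrongResolvingPartition G partition
  partition-strongly-resolving = surjective , resolved
    where
    surjective : IsPartition partition
    surjective 0F = origin , refl
    surjective (sucF 0F) = sucF 0F , refl
    surjective (sucF (sucF 0F)) = last , last-in-S₂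
      where
      last-far : n < toℕ last + toℕ last
      last-far = subst (λ t → n < t + t) (sym (toℕ-fromℕ (suc (suc k))))
                   (s≤s (s≤s (m≤n+m (suc (suc k)) k)))
      last-in-S₂ : partition last ≡ sucF (sucF 0F)
      last-in-S₂ with side (toℕ last) | side-view (toℕ last)
      ... | _ | far-half _ = refl
      ... | _ | near-half last-near = ⊥-elim (<⇒≱ last-far last-near)
      ... | _ | at-origin last≡0 = ⊥-elim (<⇒≱ last-far (subst (λ t → t + t ≤ n) (sym last≡0) z≤n))
    resolved : ∀ x y → x ≢ y → partition x ≡ partition y → ∃ λ c → StronglyResolves G partition c x y
    resolved x y x≢y same = 0F , x∉S₀ , y∉S₀ , compare (<-cmp (toℕ x) (toℕ y))
      where
      x∉S₀ : partition x ≢ 0F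
      x∉S₀ x∈S₀ =
        x≢y (trans (only-origin-in-S₀ x x∈S₀) (sym (only-origin-in-S₀ y (trans (sym same) x∈S₀))))
      y∉S₀ : partition y ≢ 0F
      y∉S₀ y∈S₀ = x∉S₀ (trans same y∈S₀)
      compare : Tri (toℕ x < toℕ y) (toℕ x ≡ toℕ y) (toℕ y < toℕ x) →
        distClass G partition 0F x ≡ dist G x y + distClass G partition 0F y ⊎
        distClass G partition 0F y ≡ dist G y x + distClass G partition 0F x
      compare (tri< x<y _ _) = same-half-resolved x y x<y same x∉S₀
      compare (tri≈ _ x≡y _) = ⊥-elim (x≢y (toℕ-injective x≡y))
      compare (tri> _ _ y<x) = swap (same-half-resolved y x y<x (sym same) y∉S₀)

  -- vertices named by natural numbers (indices beyond L are sent to the origin)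
  vertex : ℕ → Fin n
  vertex i with i <? n
  ... | yes i<n = fromℕ< i<n
  ... | no _ = origin

  toℕ-vertex : ∀ i → i < n → toℕ (vertex i) ≡ i
  toℕ-vertex i i<n with i <? n
  ... | yes _ = toℕ-fromℕ< _
  ... | no i≮n = ⊥-elim (i≮n i<n)

  vertex-toℕ : ∀ u → vertex (toℕ u) ≡ u
  vertex-toℕ u = toℕ-injective (toℕ-vertex (toℕ u) (toℕ<n u))

  toℕ-vertex-suc : ∀ i → suc i < n → toℕ (vertex (suc i)) ≡ suc (toℕ (vertex i))
  toℕ-vertex-suc i i+1<n =
    trans (toℕ-vertex (suc i) i+1<n) (cong suc (sym (toℕ-vertex i (<-trans (n<1+n i) i+1<n))))

  step-edge : ∀ i → suc i < n → T (G (vertex i) (vertex (suc i)))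
  step-edge i i+1<n = forward-edge _ _ (toℕ-vertex-suc i i+1<n)

  step-edge-back : ∀ i → suc i < n → T (G (vertex (suc i)) (vertex i))
  step-edge-back i i+1<n = backward-edge _ _ (toℕ-vertex-suc i i+1<n)

  L<n : suc (suc k) < n
  L<n = ≤-refl

  -- Walking 0, 1, …, L,
  -- the colour changes a first time after some i; then either it changes back
  -- before L (two crossing edges with distinct endpoints of the colour of 0),
  -- or the edge {L, 0} is a second crossing edge.
  module Boundary (g : Fin n → Fin 2) (surjective : IsPartition g) where

    colour : ℕ → Fin 2
    colour i = g (vertex i)

    a : Fin 2
    a = colour 0

    another-colour : ∀ (b : Fin 2) → ∃ λ w → g w ≢ b
    another-colour b with surjective (flip b)
    ... | w , gw≡flip-b = w , λ gw≡b → flip-≢ b (trans (sym gw≡flip-b) gw≡b)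

    w : Fin n
    w = proj₁ (another-colour a)

    t : ℕ
    t = toℕ w

    t<n : t < n
    t<n = toℕ<n w

    colour-t : colour t ≢ a
    colour-t = subst (λ v → g v ≢ a) (sym (vertex-toℕ w)) (proj₂ (another-colour a))

    two-crossings : ∀ i j → i < j → suc j < n → colour i ≡ a → colour (suc i) ≢ a →
      colour (suc j) ≡ a → colour j ≢ a → BoundaryPair G g
    two-crossings i j i<j j+1<n ci≡a c[1+i]≢a c[1+j]≡a cj≢a =
      boundary-pair (vertex i) (vertex (suc j)) (vertex (suc i)) (vertex j)
        distinct (trans ci≡a (sym c[1+j]≡a))
        (λ e → c[1+i]≢a (trans e ci≡a)) (λ e → cj≢a (trans e c[1+j]≡a))
        (step-edge i (≤-trans (s≤s i<j) (<⇒≤ j+1<n))) (step-edge-back j j+1<n)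
      where
      distinct : vertex i ≢ vertex (suc j)
      distinct e = <⇒≢ (m<n⇒m<1+n i<j)
        (trans (sym (toℕ-vertex i (<-trans i<j (<-trans (n<1+n j) j+1<n))))
               (trans (cong toℕ e) (toℕ-vertex (suc j) j+1<n)))

    crossing-and-wrap : ∀ i → 0 < i → suc i < n → colour i ≡ a → colour (suc i) ≢ a →
      colour (suc (suc k)) ≢ a → BoundaryPair G g
    crossing-and-wrap i 0<i i+1<n ci≡a c[1+i]≢a cL≢a =
      boundary-pair (vertex i) origin (vertex (suc i)) (vertex (suc (suc k)))
        distinct ci≡a (λ e → c[1+i]≢a (trans e ci≡a)) cL≢a
        (step-edge i i+1<n) (wrap-out-edge origin (vertex (suc (suc k))) refl (cong suc (toℕ-vertex _ L<n)))
      where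
      distinct : vertex i ≢ origin
      distinct e = <⇒≢ 0<i (sym (trans (sym (toℕ-vertex i (<-trans (n<1+n i) i+1<n))) (cong toℕ e)))

    crossings-at-origin : colour 1 ≢ a → colour (suc (suc k)) ≢ a → BoundaryPair G g
    crossings-at-origin c1≢a cL≢a =
      boundary-pair (vertex 1) (vertex (suc (suc k))) origin origin
        distinct (other-colour a (colour 1) (colour (suc (suc k))) c1≢a cL≢a)
        (λ e → c1≢a (sym e)) (λ e → cL≢a (sym e))
        (backward-edge (vertex 1) origin refl)
        (wrap-in-edge (vertex (suc (suc k))) origin refl (cong suc (toℕ-vertex _ L<n)))
      where
      distinct : vertex 1 ≢ vertex (suc (suc k))
      distinct e with trans (cong toℕ e) (toℕ-vertex _ L<n)
      ... | ()

    boundary-pair-exists : BoundaryPair G g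
    boundary-pair-exists with first-change _≟F_ colour 0 t z≤n colour-t
    ... | i , _ , i<t , ci≡a , c[1+i]≢a with colour (suc (suc k)) ≟F a
    ...   | no cL≢a with i
    ...     | zero = crossings-at-origin c[1+i]≢a cL≢a
    ...     | suc i′ = crossing-and-wrap (suc i′) (s≤s z≤n) (≤-<-trans i<t t<n) ci≡a c[1+i]≢a cL≢a
    boundary-pair-exists | i , _ , i<t , ci≡a , c[1+i]≢a | yes cL≡a
      with first-change _≟F_ colour t (suc (suc k)) (s≤s⁻¹ t<n) (λ e → colour-t (trans (sym e) cL≡a))
    ... | j , t≤j , j<L , cj≡ct , c[1+j]≢ct =
      two-crossings i j (<-≤-trans i<t t≤j) (s≤s j<L) ci≡a c[1+i]≢a
        (other-colour (colour t) (colour (suc j)) a c[1+j]≢ct (λ e → colour-t (sym e)))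
        (λ e → colour-t (trans (sym cj≡ct) e))

  fewer-classes-fail : ∀ j → j < 3 → (g : Fin n → Fin j) → ¬ IsStrongResolvingPartition G g
  fewer-classes-fail zero _ g _ with g origin
  ... | ()
  fewer-classes-fail (suc zero) _ g (_ , resolved)
    with resolved origin (sucF 0F) (λ ()) (one-class (g origin) (g (sucF 0F)))
  ... | c , origin∉c , _ = origin∉c (one-class (g origin) c)
  fewer-classes-fail (suc (suc zero)) _ g srp@(surjective , _) =
    boundary-pair-unresolvable G g (Boundary.boundary-pair-exists g surjective) srp
  fewer-classes-fail (suc (suc (suc _))) (s≤s (s≤s (s≤s ())))

proposition21 : (n : ℕ) → n ≥ 3 → StrongPartitionDimension (cycleGraph n) 3
proposition21 zero ()
proposition21 (suc zero) (s≤s ())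
proposition21 (suc (suc zero)) (s≤s (s≤s ()))
proposition21 (suc (suc (suc k))) _ =
  (partition , partition-strongly-resolving) , fewer-classes-fail
  where open CycleDimension k
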